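{- Let $A$ be a finite alphabet, let $n\leq m$, and let $u\in A^n$, $v\in A^m$ be palindromes. Then $C_{u,v} = C_{v,u}[m-n,\ldots,m-1]$; that is, $C_{u,v}[k]=C_{v,u}[m-n+k]$ for every $k\in\{0,1,\ldots,n-1\}$.
   Context: Words are indexed from $0$: $u=u[0]\cdots u[n-1]$, and $w[a,\ldots,b]$ denotes the factor $w[a]\cdots w[b]$. A palindrome is a word equal to its reversal. Write $[n]=\{0,\ldots,n-1\}$. For $u\in A^n$, $v\in A^m$, the correlation of $u$ over $v$ is the binary word $C_{u,v}$ of length $n$ such that for $k\in[n]$, $C_{u,v}[k]=1$ if $u[i]=v[j]$ for all $i\in[n]$, $j\in[m]$ with $i=j+k$, and $C_{u,v}[k]=0$ otherwise. -}

module Defs where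

open import Data.Nat using (ℕ; _+_; _<_; _<?_)
open import Data.Fin using (Fin; toℕ; fromℕ<)
import Data.Fin.Properties as FinP
open import Data.Bool using (Bool; true; false; _∧_)
open import Data.Vec using (Vec; lookup; reverse; allFin; foldr)
open import Relation.Nullary using (does; yes; no)
open import Relation.Binary.PropositionalEquality using (_≡_)

-- Finite alphabet: A = Fin s (any finite alphabet up to renaming).
-- A word of length n over A is a Vec (Fin s) n, indexed from 0.

IsPalindrome : {s n : ℕ} → Vec (Fin s) n → Set
IsPalindrome w = reverse w ≡ w

-- For fixed k, j : the condition "if i = j + k ∈ [n] then u[i] = v[j]".
-- (Pairs (i,j) with i = j + k are exactly those j ∈ [m] with j + k < n.)
corrAt : {s n m : ℕ} → Vec (Fin s) n → Vec (Fin s) m → ℕ → Fin m → Bool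
corrAt {n = n} u v k j with toℕ j + k <? n
... | yes lt = does (lookup u (fromℕ< lt) FinP.≟ lookup v j)
... | no _ = true

corrBit : {s n m : ℕ} → Vec (Fin s) n → Vec (Fin s) m → ℕ → Bool
corrBit {m = m} u v k = foldr _ (λ j acc → corrAt u v k j ∧ acc) true (allFin m)

correlation : {s n m : ℕ} → Vec (Fin s) n → Vec (Fin s) m → Vec Bool n
correlation u v = Data.Vec.tabulate (λ k → corrBit u v (toℕ k))

-- Reading both words backwards turns an alignment of u over v at offset k into an
-- alignment of v over u at offset (m − n) + k: position i of u and position j of v
-- become positions n − 1 − i and m − 1 − j, and (m − 1 − j) − (n − 1 − i) = (m − n) + k
-- exactly when i − j = k. Palindromes are their own reversals, so the two bits agree.
module Submission where

open import Defs
open import Data.Bool using (Bool; true; false; _∧_)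
open import Data.Bool.Properties using (⇔→≡)
open import Data.Empty using (⊥-elim)
open import Data.Fin using (Fin; toℕ; fromℕ; fromℕ<; inject₁; opposite; zero; suc)
open import Data.Fin.Properties
  using (_≟_; toℕ<n; toℕ-injective; toℕ-fromℕ<; opposite-prop; opposite-involutive)
open import Data.Nat using (ℕ; _≤_; _<_; _∸_; _+_; _<?_)
  renaming (suc to sucℕ)
open import Data.Nat.Properties using (+-assoc; +-comm; +-cancelˡ-≡; +-cancelʳ-≡; m∸n+n≡m; suc-injective)
open import Data.Vec using (Vec; []; _∷_; _∷ʳ_; lookup; reverse; foldr; allFin)
open import Data.Vec.Properties using (reverse-∷; lookup∘tabulate; lookup-allFin)
open import Function.Bundles using (_⇔_; mk⇔; Equivalence)
open import Function.Properties.Equivalence using () renaming (trans to ⇔-trans; sym to ⇔-sym)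
open import Relation.Nullary using (yes; no)
open import Relation.Binary.PropositionalEquality
  using (_≡_; refl; sym; trans; cong; subst; subst₂; module ≡-Reasoning)

private
  variable
    A : Set
    s n m : ℕ

lookup-∷ʳ-inject₁ : (xs : Vec A n) (x : A) (i : Fin n) → lookup (xs ∷ʳ x) (inject₁ i) ≡ lookup xs i
lookup-∷ʳ-inject₁ (y ∷ ys) x zero    = refl
lookup-∷ʳ-inject₁ (y ∷ ys) x (suc i) = lookup-∷ʳ-inject₁ ys x i

lookup-∷ʳ-last : (xs : Vec A n) (x : A) → lookup (xs ∷ʳ x) (fromℕ n) ≡ x
lookup-∷ʳ-last []       x = refl
lookup-∷ʳ-last (y ∷ ys) x = lookup-∷ʳ-last ys x

lookup-reverse-opposite : (xs : Vec A n) (i : Fin n) → lookup (reverse xs) (opposite i) ≡ lookup xs i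
lookup-reverse-opposite {n = sucℕ n} (x ∷ xs) zero = begin
  lookup (reverse (x ∷ xs)) (fromℕ n) ≡⟨ cong (λ w → lookup w (fromℕ n)) (reverse-∷ x xs) ⟩
  lookup (reverse xs ∷ʳ x) (fromℕ n)  ≡⟨ lookup-∷ʳ-last (reverse xs) x ⟩
  x                                    ∎
  where open ≡-Reasoning
lookup-reverse-opposite (x ∷ xs) (suc i) = begin
  lookup (reverse (x ∷ xs)) (inject₁ (opposite i)) ≡⟨ cong (λ w → lookup w (inject₁ (opposite i))) (reverse-∷ x xs) ⟩
  lookup (reverse xs ∷ʳ x) (inject₁ (opposite i))  ≡⟨ lookup-∷ʳ-inject₁ (reverse xs) x (opposite i) ⟩
  lookup (reverse xs) (opposite i)                 ≡⟨ lookup-reverse-opposite xs i ⟩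
  lookup xs i                                      ∎
  where open ≡-Reasoning

lookup-reverse : (xs : Vec A n) (i : Fin n) → lookup (reverse xs) i ≡ lookup xs (opposite i)
lookup-reverse xs i =
  subst (λ j → lookup (reverse xs) j ≡ lookup xs (opposite i))
        (opposite-involutive i) (lookup-reverse-opposite xs (opposite i))

foldr-∧-true⇔ : (p : A → Bool) (xs : Vec A n) →
  foldr (λ _ → Bool) (λ x acc → p x ∧ acc) true xs ≡ true ⇔ (∀ i → p (lookup xs i) ≡ true)
foldr-∧-true⇔ p xs = mk⇔ (to xs) (from xs)
  where
  to : (xs : Vec _ n) → foldr (λ _ → Bool) (λ x acc → p x ∧ acc) true xs ≡ true →
       ∀ i → p (lookup xs i) ≡ true
  to []       _ ()
  to (x ∷ xs) all-true with p x in px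
  to (x ∷ xs) ()       | false
  to (x ∷ xs) all-true | true = λ { zero → px ; (suc i) → to xs all-true i }

  from : (xs : Vec _ n) → (∀ i → p (lookup xs i) ≡ true) →
         foldr (λ _ → Bool) (λ x acc → p x ∧ acc) true xs ≡ true
  from []       h = refl
  from (x ∷ xs) h rewrite h zero = from xs (λ i → h (suc i))

foldr-∧-allFin-true⇔ : (p : Fin n → Bool) →
  foldr (λ _ → Bool) (λ x acc → p x ∧ acc) true (allFin n) ≡ true ⇔ (∀ i → p i ≡ true)
foldr-∧-allFin-true⇔ p = mk⇔
  (λ all-true i → subst (λ j → p j ≡ true) (lookup-allFin i)
                          (Equivalence.to (foldr-∧-true⇔ p (allFin _)) all-true i))
  (λ h → Equivalence.from (foldr-∧-true⇔ p (allFin _)) (λ i → h (lookup (allFin _) i)))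

Matches : Vec A n → Vec A m → ℕ → Set
Matches {n = n} {m = m} u v k = (i : Fin n) (j : Fin m) → toℕ i ≡ toℕ j + k → lookup u i ≡ lookup v j

corrAt-true⇔ : (u : Vec (Fin s) n) (v : Vec (Fin s) m) (k : ℕ) (j : Fin m) →
  corrAt u v k j ≡ true ⇔ ((i : Fin n) → toℕ i ≡ toℕ j + k → lookup u i ≡ lookup v j)
corrAt-true⇔ {n = n} u v k j with toℕ j + k <? n
... | no j+k≮n = mk⇔ (λ _ i i≡j+k → ⊥-elim (j+k≮n (subst (_< n) i≡j+k (toℕ<n i)))) (λ _ → refl)
... | yes j+k<n with lookup u (fromℕ< j+k<n) ≟ lookup v j
...   | yes uv = mk⇔ (λ _ i i≡j+k → trans (cong (lookup u) (i≡fromℕ< i≡j+k)) uv) (λ _ → refl)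
  where
  i≡fromℕ< : ∀ {i} → toℕ i ≡ toℕ j + k → i ≡ fromℕ< j+k<n
  i≡fromℕ< i≡j+k = toℕ-injective (trans i≡j+k (sym (toℕ-fromℕ< j+k<n)))
...   | no ¬uv = mk⇔ (λ ()) (λ h → ⊥-elim (¬uv (h (fromℕ< j+k<n) (toℕ-fromℕ< j+k<n))))

corrBit-true⇔ : (u : Vec (Fin s) n) (v : Vec (Fin s) m) (k : ℕ) → corrBit u v k ≡ true ⇔ Matches u v k
corrBit-true⇔ u v k = mk⇔
  (λ bit i j → Equivalence.to (corrAt-true⇔ u v k j)
                 (Equivalence.to (foldr-∧-allFin-true⇔ (corrAt u v k)) bit j) i)
  (λ h → Equivalence.from (foldr-∧-allFin-true⇔ (corrAt u v k))
           (λ j → Equivalence.from (corrAt-true⇔ u v k j) (λ i → h i j)))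

offset-reflect : ∀ {p r i j k} → p + sucℕ j ≡ r + sucℕ i → (i ≡ j + k ⇔ p ≡ r + k)
offset-reflect {p} {r} {i} {j} {k} p+1+j≡r+1+i = mk⇔ to from
  where
  open ≡-Reasoning
  to : i ≡ j + k → p ≡ r + k
  to i≡j+k = +-cancelʳ-≡ (sucℕ j) p (r + k) (begin
    p + sucℕ j       ≡⟨ p+1+j≡r+1+i ⟩
    r + sucℕ i       ≡⟨ cong (λ x → r + sucℕ x) i≡j+k ⟩
    r + (sucℕ j + k) ≡⟨ cong (r +_) (+-comm (sucℕ j) k) ⟩
    r + (k + sucℕ j) ≡⟨ +-assoc r k (sucℕ j) ⟨
    r + k + sucℕ j   ∎)
  from : p ≡ r + k → i ≡ j + k
  from p≡r+k = suc-injective (begin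
    sucℕ i       ≡⟨ +-cancelˡ-≡ r (sucℕ i) (k + sucℕ j) (begin
      r + sucℕ i       ≡⟨ p+1+j≡r+1+i ⟨
      p + sucℕ j       ≡⟨ cong (_+ sucℕ j) p≡r+k ⟩
      r + k + sucℕ j   ≡⟨ +-assoc r k (sucℕ j) ⟩
      r + (k + sucℕ j) ∎) ⟩
    k + sucℕ j   ≡⟨ +-comm k (sucℕ j) ⟩
    sucℕ (j + k) ∎)

opposite-offset⇔ : {k : ℕ} → n ≤ m → (i : Fin n) (j : Fin m) →
  toℕ i ≡ toℕ j + k ⇔ toℕ (opposite j) ≡ toℕ (opposite i) + ((m ∸ n) + k)
opposite-offset⇔ {n = n} {m = m} {k = k} n≤m i j =
  subst (λ x → toℕ i ≡ toℕ j + k ⇔ toℕ (opposite j) ≡ x)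
        (+-assoc (toℕ (opposite i)) (m ∸ n) k)
        (offset-reflect (begin
          toℕ (opposite j) + sucℕ (toℕ j)           ≡⟨ cong (_+ sucℕ (toℕ j)) (opposite-prop j) ⟩
          m ∸ sucℕ (toℕ j) + sucℕ (toℕ j)           ≡⟨ m∸n+n≡m (toℕ<n j) ⟩
          m                                          ≡⟨ m∸n+n≡m n≤m ⟨
          m ∸ n + n                                  ≡⟨ cong (m ∸ n +_) (m∸n+n≡m (toℕ<n i)) ⟨
          m ∸ n + (n ∸ sucℕ (toℕ i) + sucℕ (toℕ i)) ≡⟨ cong (λ x → m ∸ n + (x + sucℕ (toℕ i))) (opposite-prop i) ⟨
          m ∸ n + (toℕ (opposite i) + sucℕ (toℕ i)) ≡⟨ +-assoc (m ∸ n) _ _ ⟨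
          m ∸ n + toℕ (opposite i) + sucℕ (toℕ i)   ≡⟨ cong (_+ sucℕ (toℕ i)) (+-comm (m ∸ n) _) ⟩
          toℕ (opposite i) + (m ∸ n) + sucℕ (toℕ i) ∎))
  where open ≡-Reasoning

matches-reverse⇔ : {k : ℕ} → n ≤ m → (u : Vec A n) (v : Vec A m) →
  Matches u v k ⇔ Matches (reverse v) (reverse u) ((m ∸ n) + k)
matches-reverse⇔ {n = n} {m = m} {k = k} n≤m u v = mk⇔ to from
  where
  open ≡-Reasoning
  to : Matches u v k → Matches (reverse v) (reverse u) ((m ∸ n) + k)
  to h i j i≡j+m-n+k = begin
    lookup (reverse v) i        ≡⟨ lookup-reverse v i ⟩
    lookup v (opposite i)       ≡⟨ h (opposite j) (opposite i) offset ⟨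
    lookup u (opposite j)       ≡⟨ lookup-reverse u j ⟨
    lookup (reverse u) j        ∎
    where
    offset : toℕ (opposite j) ≡ toℕ (opposite i) + k
    offset = Equivalence.from (opposite-offset⇔ n≤m (opposite j) (opposite i))
      (subst₂ (λ i′ j′ → toℕ i′ ≡ toℕ j′ + ((m ∸ n) + k))
              (sym (opposite-involutive i)) (sym (opposite-involutive j)) i≡j+m-n+k)
  from : Matches (reverse v) (reverse u) ((m ∸ n) + k) → Matches u v k
  from h i j i≡j+k = begin
    lookup u i                       ≡⟨ lookup-reverse-opposite u i ⟨
    lookup (reverse u) (opposite i)  ≡⟨ h (opposite j) (opposite i) (Equivalence.to (opposite-offset⇔ n≤m i j) i≡j+k) ⟨
    lookup (reverse v) (opposite j)  ≡⟨ lookup-reverse-opposite v j ⟩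
    lookup v j                       ∎

theorem1 : (s n m : ℕ) → n ≤ m → (u : Vec (Fin s) n) → (v : Vec (Fin s) m) →
    IsPalindrome u → IsPalindrome v →
    (k : Fin n) → (i : Fin m) → toℕ i ≡ (m ∸ n) + toℕ k →
    lookup (correlation u v) k ≡ lookup (correlation v u) i
theorem1 s n m n≤m u v u-pal v-pal k i i≡m-n+k = begin
  lookup (correlation u v) k     ≡⟨ lookup∘tabulate (λ k → corrBit u v (toℕ k)) k ⟩
  corrBit u v (toℕ k)            ≡⟨ ⇔→≡ bits⇔ ⟩
  corrBit v u ((m ∸ n) + toℕ k)  ≡⟨ cong (corrBit v u) i≡m-n+k ⟨
  corrBit v u (toℕ i)            ≡⟨ lookup∘tabulate (λ i → corrBit v u (toℕ i)) i ⟨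
  lookup (correlation v u) i     ∎
  where
  open ≡-Reasoning
  bits⇔ : corrBit u v (toℕ k) ≡ true ⇔ corrBit v u ((m ∸ n) + toℕ k) ≡ true
  bits⇔ = ⇔-trans (corrBit-true⇔ u v (toℕ k))
    (⇔-trans (subst₂ (λ x y → Matches u v (toℕ k) ⇔ Matches x y ((m ∸ n) + toℕ k)) v-pal u-pal
                     (matches-reverse⇔ n≤m u v))
             (⇔-sym (corrBit-true⇔ v u ((m ∸ n) + toℕ k))))
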